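{- Let $n=p_1^{\alpha_1}p_2^{\alpha_2}p_3^{\alpha_3}$, where $\alpha_1,\alpha_2,\alpha_3$ are positive integers and $p_1<p_2<p_3$ are prime numbers. Let $\{i,j,k\}=\{1,2,3\}$ with $i<j$. If $(p_i+p_j)\phi(p_jp_k)-p_ip_jp_k>0$, then $\deg(p_i^{\beta_i}p_j)>\deg(p_j)$ in $\mathcal{P}(C_n)$ for every $1\leq\beta_i\leq\alpha_i$.
   Context: For a finite group $G$, the power graph $\mathcal{P}(G)$ is the simple undirected graph with vertex set $G$ in which two distinct vertices are adjacent if one of them is an integral power of the other. $C_n$ denotes the cyclic group of order $n$, identified with $\mathbb{Z}_n=\{0,1,\ldots,n-1\}$; a positive divisor $d$ of $n$ is regarded as the vertex $d \bmod n$. $\deg(a)$ denotes the degree of vertex $a$ in $\mathcal{P}(C_n)$ and $\phi$ Euler's totient function. -}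

module Defs where

open import Data.Nat using (ℕ; zero; suc; _*_; _%_; _≡ᵇ_)
open import Data.Nat.GCD using (gcd)
open import Data.Bool using (Bool; true; false; not; _∧_; _∨_)
open import Data.Bool.ListAction using (any)
open import Data.List using (List; upTo; filterᵇ; length; map)

φ : ℕ → ℕ
φ n = length (filterᵇ (λ k → gcd k n ≡ᵇ 1) (map suc (upTo n)))

-- C_n identified with ℤ_n = {0,…,n-1}; group operation is addition mod n,
-- so the integral powers of b are the multiples m·b (mod n).  Since m·b mod n
-- is periodic in m with period n, every integral power of b is k·b mod n
-- for some k ∈ {0,…,n-1} (negative m ≡ m + t·n for suitable t).
-- isPowerOf n a b = true  iff  a is an integral power of b in C_n
-- (a, b are assumed already reduced to {0,…,n-1}).
isPowerOf : (n : ℕ) → ℕ → ℕ → Bool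
isPowerOf zero    a b = false
isPowerOf (suc m) a b = any (λ k → ((k * b) % suc m) ≡ᵇ a) (upTo (suc m))

adjacent : (n : ℕ) → ℕ → ℕ → Bool
adjacent n a b = not (a ≡ᵇ b) ∧ (isPowerOf n a b ∨ isPowerOf n b a)

deg : (n : ℕ) → ℕ → ℕ
deg zero    a = 0
deg (suc m) a = length (filterᵇ (adjacent (suc m) (a % suc m)) (upTo (suc m)))

module Submission where

-- Write q = p_i, r = p_j, s = p_k, N = n, g = q^β r.
--
-- In ℤ_N, x is a power of y iff gcd(y, N) ∣ x.  Hence the closed neighbourhood of
-- the prime r lies in {multiples of r} ∪ {units}, so deg r + 1 ≤ N/r + φ(N), while
-- the closed neighbourhood of g contains the multiples of g, the units and every
-- residue y whose gcd with N is q^a (1 ≤ a ≤ β) or q^a r (a < β).  A gcd-class with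
-- cofactor m = N/d has φ(m) ≥ m (q-1)(r-1)(s-1)/(q r s) members (product formula),
-- and the hypothesis, via φ(r s) ≤ (r-1)(s-1), makes the classes of q^(a+1) and
-- q^a r together exceed (q-1)·N/(q^(β-a) r); these differences telescope to N/r - N/g.

open import Defs
open import Data.Nat using (ℕ; _+_; _*_; _^_; _<_; _≤_)
open import Data.Nat.Primality using (Prime)
open import Data.Fin using (Fin; zero; suc; toℕ)
open import Data.Integer using (ℤ; +_; _-_) renaming (_<_ to _<ℤ_)
open import Relation.Binary.PropositionalEquality using (_≡_; _≢_)

open import Data.Nat using (zero; suc; pred; _∸_; z≤n; s≤s; _≡ᵇ_; NonZero; >-nonZero; ≢-nonZero; nonTrivial⇒n>1; _<?_)
open import Data.Nat.Properties
open import Data.Nat.Divisibility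
open import Data.Nat.DivMod using (_%_; m%n<n; m<n⇒m%n≡m; %-distribˡ-*; m%n%n≡m%n; [m+kn]%n≡m%n)
open import Data.Nat.GCD
open import Data.Nat.Coprimality using (Coprime; coprime-factors; coprime⇒gcd≡1)
open import Data.Nat.Primality using (euclidsLemma; prime⇒irreducible; prime⇒nonTrivial)
open import Data.Nat.Tactic.RingSolver using (solve-∀)
open import Data.Bool using (Bool; true; false; not; _∧_; _∨_; T; if_then_else_)
open import Data.Bool.Properties using (T-∧; T-∨)
open import Data.Bool.ListAction using (all)
open import Data.List using (List; []; _∷_; [_]; _++_; upTo; filterᵇ; length; map)
open import Data.Nat.ListAction using (product)
open import Data.List.Properties using (upTo-∷ʳ)
open import Data.List.Relation.Unary.All using (All; []; _∷_)
open import Data.List.Relation.Unary.AllPairs using ([]; _∷_)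
open import Data.List.Relation.Unary.Unique.Propositional using (Unique)
open import Data.List.Relation.Unary.Any using (satisfied)
open import Data.List.Relation.Unary.Any.Properties using (any⁺; any⁻)
open import Data.List.Membership.Propositional using (lose)
open import Data.List.Membership.Propositional.Properties using (∈-upTo⁺)
open import Data.Unit using (tt)
open import Data.Empty using (⊥; ⊥-elim)
open import Data.Product using (∃; _×_; _,_; proj₁; proj₂)
open import Data.Sum using (_⊎_; inj₁; inj₂)
open import Function using (_∘_)
open import Function.Bundles using (Equivalence)
open import Relation.Binary.PropositionalEquality using (refl; sym; trans; cong; cong₂; subst; ≢-sym; module ≡-Reasoning)
open import Relation.Binary.Definitions using (tri<; tri≈; tri>)
open import Relation.Nullary using (¬_; Dec; yes; no)
open import Relation.Nullary.Decidable using (⌊_⌋)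
open import Data.Integer using (+<+) renaming (-_ to -ℤ_)
import Data.Integer.Properties as ℤ

indicator : Bool → ℕ
indicator true  = 1
indicator false = 0

T∨ˡ : ∀ {a b} → T a → T (a ∨ b)
T∨ˡ {true} _ = tt

T∨ʳ : ∀ {a b} → T b → T (a ∨ b)
T∨ʳ {true}  _ = tt
T∨ʳ {false} t = t

T∨-elim : ∀ {a b} → T (a ∨ b) → T a ⊎ T b
T∨-elim = Equivalence.to T-∨

≡ᵇ-refl : ∀ x → (x ≡ᵇ x) ≡ true
≡ᵇ-refl zero    = refl
≡ᵇ-refl (suc x) = ≡ᵇ-refl x

≡ᵇ-cong : ∀ {x y u v} → (x ≡ y → u ≡ v) → (u ≡ v → x ≡ y) → (x ≡ᵇ y) ≡ (u ≡ᵇ v)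
≡ᵇ-cong {x} {y} {u} {v} to from with x ≡ᵇ y in e₁ | u ≡ᵇ v in e₂
... | true  | true  = refl
... | false | false = refl
... | true  | false = ⊥-elim (subst T e₂ (≡⇒≡ᵇ u v (to (≡ᵇ⇒≡ x y (subst T (sym e₁) tt)))))
... | false | true  = ⊥-elim (subst T e₁ (≡⇒≡ᵇ x y (from (≡ᵇ⇒≡ u v (subst T (sym e₂) tt)))))

count : ℕ → (ℕ → Bool) → ℕ
count zero    f = 0
count (suc n) f = count n f + indicator (f n)

length-filter-upTo : ∀ n f → length (filterᵇ f (upTo n)) ≡ count n f
length-filter-upTo zero    f = refl
length-filter-upTo (suc n) f = begin
    length (filterᵇ f (upTo (suc n)))       ≡⟨ cong (length ∘ filterᵇ f) (sym (upTo-∷ʳ n)) ⟩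
    length (filterᵇ f (upTo n ++ [ n ]))    ≡⟨ length-filter-snoc (upTo n) ⟩
    length (filterᵇ f (upTo n)) + indicator (f n) ≡⟨ cong (_+ indicator (f n)) (length-filter-upTo n f) ⟩
    count n f + indicator (f n)             ∎
  where
  open ≡-Reasoning
  length-filter-snoc : ∀ xs → length (filterᵇ f (xs ++ [ n ])) ≡ length (filterᵇ f xs) + indicator (f n)
  length-filter-snoc [] with f n
  ... | true  = refl
  ... | false = refl
  length-filter-snoc (x ∷ xs) with f x
  ... | true  = cong suc (length-filter-snoc xs)
  ... | false = length-filter-snoc xs

count-cong : ∀ n {f g : ℕ → Bool} → (∀ x → x < n → f x ≡ g x) → count n f ≡ count n g
count-cong zero    eq = refl
count-cong (suc n) eq = cong₂ _+_ (count-cong n (λ x x<n → eq x (m<n⇒m<1+n x<n))) (cong indicator (eq n ≤-refl))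

count-mono : ∀ n {f g : ℕ → Bool} → (∀ x → x < n → T (f x) → T (g x)) → count n f ≤ count n g
count-mono zero    f⇒g = z≤n
count-mono (suc n) f⇒g = +-mono-≤ (count-mono n (λ x x<n → f⇒g x (m<n⇒m<1+n x<n))) (indicator-mono (f⇒g n ≤-refl))
  where
  indicator-mono : ∀ {a b} → (T a → T b) → indicator a ≤ indicator b
  indicator-mono {false}         _ = z≤n
  indicator-mono {true} {true}   _ = ≤-refl
  indicator-mono {true} {false} h = ⊥-elim (h tt)

count-none : ∀ n (f : ℕ → Bool) → (∀ x → x < n → ¬ T (f x)) → count n f ≡ 0
count-none zero    f none = refl
count-none (suc n) f none with f n in fn
... | true  = ⊥-elim (none n ≤-refl (subst T (sym fn) tt))
... | false = trans (+-identityʳ _) (count-none n f (λ x x<n → none x (m<n⇒m<1+n x<n)))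

count-all : ∀ n → count n (λ _ → true) ≡ n
count-all zero    = refl
count-all (suc n) = trans (cong (_+ 1) (count-all n)) (+-comm n 1)

count-∨ : ∀ n (f g : ℕ → Bool) → count n (λ x → f x ∨ g x) + count n (λ x → f x ∧ g x) ≡ count n f + count n g
count-∨ zero    f g = refl
count-∨ (suc n) f g = begin
    (count n f∨g + indicator (f n ∨ g n)) + (count n f∧g + indicator (f n ∧ g n))
      ≡⟨ interchange (count n f∨g) _ _ _ ⟩
    (count n f∨g + count n f∧g) + (indicator (f n ∨ g n) + indicator (f n ∧ g n))
      ≡⟨ cong₂ _+_ (count-∨ n f g) (indicator-∨ (f n) (g n)) ⟩
    (count n f + count n g) + (indicator (f n) + indicator (g n))
      ≡⟨ interchange (count n f) _ _ _ ⟩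
    (count n f + indicator (f n)) + (count n g + indicator (g n)) ∎
  where
  open ≡-Reasoning
  f∨g f∧g : ℕ → Bool
  f∨g x = f x ∨ g x
  f∧g x = f x ∧ g x
  interchange : ∀ a b c d → (a + b) + (c + d) ≡ (a + c) + (b + d)
  interchange = solve-∀
  indicator-∨ : ∀ a b → indicator (a ∨ b) + indicator (a ∧ b) ≡ indicator a + indicator b
  indicator-∨ true  true  = refl
  indicator-∨ true  false = refl
  indicator-∨ false true  = refl
  indicator-∨ false false = refl

count-∨-≤ : ∀ n (f g : ℕ → Bool) → count n (λ x → f x ∨ g x) ≤ count n f + count n g
count-∨-≤ n f g = subst (count n (λ x → f x ∨ g x) ≤_) (count-∨ n f g) (m≤m+n _ _)

count-disjoint : ∀ n (f g : ℕ → Bool) → (∀ x → x < n → T (f x) → T (g x) → ⊥) →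
  count n (λ x → f x ∨ g x) ≡ count n f + count n g
count-disjoint n f g disjoint = begin
    count n (λ x → f x ∨ g x)                            ≡⟨ sym (+-identityʳ _) ⟩
    count n (λ x → f x ∨ g x) + 0                        ≡⟨ cong (_+_ (count n (λ x → f x ∨ g x))) (sym none) ⟩
    count n (λ x → f x ∨ g x) + count n (λ x → f x ∧ g x) ≡⟨ count-∨ n f g ⟩
    count n f + count n g                                ∎
  where
  open ≡-Reasoning
  none : count n (λ x → f x ∧ g x) ≡ 0
  none = count-none n _ (λ x x<n fg → let (fx , gx) = Equivalence.to T-∧ fg in disjoint x x<n fx gx)

count-+ : ∀ a b (f : ℕ → Bool) → count (a + b) f ≡ count a f + count b (λ t → f (a + t))
count-+ a zero    f = trans (cong (λ z → count z f) (+-identityʳ a)) (sym (+-identityʳ _))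
count-+ a (suc b) f = begin
    count (a + suc b) f                                                ≡⟨ cong (λ z → count z f) (+-suc a b) ⟩
    count (a + b) f + indicator (f (a + b))                            ≡⟨ cong (_+ indicator (f (a + b))) (count-+ a b f) ⟩
    (count a f + count b (λ t → f (a + t))) + indicator (f (a + b))    ≡⟨ +-assoc (count a f) _ _ ⟩
    count a f + count (suc b) (λ t → f (a + t))                        ∎
  where open ≡-Reasoning

count-point : ∀ n x₀ → x₀ < n → count n (λ x → x ≡ᵇ x₀) ≡ 1
count-point (suc n) x₀ x₀<1+n with x₀ ≟ n
... | yes refl = cong₂ _+_ (count-none n _ (λ x x<n x≡x₀ → <-irrefl (≡ᵇ⇒≡ x x₀ x≡x₀) x<n))
                           (cong indicator (≡ᵇ-refl x₀))
... | no x₀≢n = cong₂ _+_ (count-point n x₀ (≤∧≢⇒< (≤-pred x₀<1+n) x₀≢n)) (cong indicator n≢x₀)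
  where
  n≢x₀ : (n ≡ᵇ x₀) ≡ false
  n≢x₀ with n ≡ᵇ x₀ in eq
  ... | true  = ⊥-elim (x₀≢n (sym (≡ᵇ⇒≡ n x₀ (subst T (sym eq) tt))))
  ... | false = refl

count-multiples : ∀ d' m (f : ℕ → Bool) → (∀ x → T (f x) → suc d' ∣ x) →
  count (suc d' * m) f ≡ count m (λ w → f (suc d' * w))
count-multiples d' zero    f only-multiples = cong (λ z → count z f) (*-zeroʳ d')
count-multiples d' (suc m) f only-multiples = begin
    count (d * suc m) f                                   ≡⟨ cong (λ z → count z f) (trans (*-suc d m) (+-comm d (d * m))) ⟩
    count (d * m + suc d') f                              ≡⟨ count-+ (d * m) (suc d') f ⟩
    count (d * m) f + count (suc d') (λ t → f (d * m + t)) ≡⟨ cong₂ _+_ (count-multiples d' m f only-multiples) block ⟩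
    count m (λ w → f (d * w)) + indicator (f (d * m))     ∎
  where
  open ≡-Reasoning
  d : ℕ
  d = suc d'
  -- inside the block [d*m, d*m + d) only d*m itself can satisfy f
  block : count (suc d') (λ t → f (d * m + t)) ≡ indicator (f (d * m))
  block = begin
      count (suc d') (λ t → f (d * m + t))                                  ≡⟨ count-+ 1 d' _ ⟩
      indicator (f (d * m + 0)) + count d' (λ t → f (d * m + suc t))
        ≡⟨ cong₂ _+_ (cong (indicator ∘ f) (+-identityʳ _)) (count-none d' _ off) ⟩
      indicator (f (d * m)) + 0                                             ≡⟨ +-identityʳ _ ⟩
      indicator (f (d * m))                                                 ∎
    where
    off : ∀ t → t < d' → ¬ T (f (d * m + suc t))
    off t t<d' ft = <-irrefl refl (≤-trans (∣⇒≤ (∣m+n∣m⇒∣n (only-multiples _ ft) (m∣m*n m))) t<d')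

-- Divisibility and primes

_∣ᵇ_ : ℕ → ℕ → Bool
d ∣ᵇ y = ⌊ d ∣? y ⌋

∣ᵇ⇒∣ : ∀ {d y} → T (d ∣ᵇ y) → d ∣ y
∣ᵇ⇒∣ {d} {y} t with d ∣? y
... | yes d∣y = d∣y

∣⇒∣ᵇ : ∀ {d y} → d ∣ y → T (d ∣ᵇ y)
∣⇒∣ᵇ {d} {y} d∣y with d ∣? y
... | yes _  = tt
... | no d∤y = d∤y d∣y

∣ᵇ-cong : ∀ {d a b} → (d ∣ a → d ∣ b) → (d ∣ b → d ∣ a) → d ∣ᵇ a ≡ d ∣ᵇ b
∣ᵇ-cong {d} {a} {b} a⇒b b⇒a with d ∣? a | d ∣? b
... | yes _   | yes _   = refl
... | no _    | no _    = refl
... | yes d∣a | no d∤b  = ⊥-elim (d∤b (a⇒b d∣a))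
... | no d∤a  | yes d∣b = ⊥-elim (d∤a (b⇒a d∣b))

∣ᵇ-refl : ∀ d w → d ∣ᵇ (d * w) ≡ true
∣ᵇ-refl d w with d ∣? (d * w)
... | yes _  = refl
... | no d∤ = ⊥-elim (d∤ (m∣m*n w))

count-divisible : ∀ d m → 0 < d → count (d * m) (d ∣ᵇ_) ≡ m
count-divisible (suc d') m _ = begin
    count (suc d' * m) (suc d' ∣ᵇ_)                ≡⟨ count-multiples d' m _ (λ _ → ∣ᵇ⇒∣) ⟩
    count m (λ w → suc d' ∣ᵇ (suc d' * w))         ≡⟨ count-cong m (λ w _ → ∣ᵇ-refl (suc d') w) ⟩
    count m (λ _ → true)                           ≡⟨ count-all m ⟩
    m                                              ∎
  where open ≡-Reasoning

^-∣ : ∀ x {a b} → a ≤ b → x ^ a ∣ x ^ b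
^-∣ x {a} {b} a≤b with m≤n⇒∃[o]m+o≡n a≤b
... | k , refl = divides (x ^ k) (trans (^-distribˡ-+-* x a k) (*-comm (x ^ a) (x ^ k)))

prime>1 : ∀ {p} → Prime p → 1 < p
prime>1 {p} p-prime = nonTrivial⇒n>1 p {{prime⇒nonTrivial p-prime}}

prime>0 : ∀ {p} → Prime p → 0 < p
prime>0 p-prime = <-trans (s≤s z≤n) (prime>1 p-prime)

prime∣prime : ∀ {p q} → Prime p → Prime q → p ∣ q → p ≡ q
prime∣prime p-prime q-prime p∣q with prime⇒irreducible q-prime p∣q
... | inj₂ p≡q  = p≡q
... | inj₁ refl = ⊥-elim (<-irrefl refl (prime>1 p-prime))

prime∣^ : ∀ {p q} a → Prime p → p ∣ q ^ a → p ∣ q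
prime∣^ zero    p-prime p∣1 = ⊥-elim (<-irrefl (sym (∣1⇒≡1 p∣1)) (prime>1 p-prime))
prime∣^ {q = q} (suc a) p-prime p∣q^1+a with euclidsLemma q (q ^ a) p-prime p∣q^1+a
... | inj₁ p∣q   = p∣q
... | inj₂ p∣q^a = prime∣^ a p-prime p∣q^a

∣ᵇ-skip : ∀ {p' p} x → Prime p' → Prime p → p' ≢ p → p' ∣ᵇ (p * x) ≡ p' ∣ᵇ x
∣ᵇ-skip {p'} {p} x p'-prime p-prime p'≢p = ∣ᵇ-cong cancel (∣n⇒∣m*n p)
  where
  cancel : p' ∣ p * x → p' ∣ x
  cancel p'∣px with euclidsLemma p x p'-prime p'∣px
  ... | inj₁ p'∣p = ⊥-elim (p'≢p (prime∣prime p'-prime p-prime p'∣p))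
  ... | inj₂ p'∣x = p'∣x

coprime-* : ∀ {a b c} → Coprime a b → Coprime a c → Coprime a (b * c)
coprime-* {c = c} a⊥b a⊥c (i∣a , i∣bc) = a⊥c (i∣a , coprime-factors a⊥b (∣m⇒∣m*n c i∣a , i∣bc))

coprime-^ : ∀ {a b} k → Coprime a b → Coprime a (b ^ k)
coprime-^ zero    a⊥b (_ , i∣1) = ∣1⇒≡1 i∣1
coprime-^ (suc k) a⊥b = coprime-* a⊥b (coprime-^ k a⊥b)

coprime-prime : ∀ {w p} → Prime p → ¬ p ∣ w → Coprime w p
coprime-prime p-prime p∤w (i∣w , i∣p) with prime⇒irreducible p-prime i∣p
... | inj₁ i≡1 = i≡1
... | inj₂ refl = ⊥-elim (p∤w i∣w)

-- The product formula for counting integers prime to a set of primes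

dividing : ℕ → List ℕ → List ℕ
dividing m []      = []
dividing m (p ∷ P) = if p ∣ᵇ m then p ∷ dividing m P else dividing m P

avoids : List ℕ → ℕ → ℕ → Bool
avoids P m w = all (λ p → not (p ∣ᵇ m ∧ p ∣ᵇ w)) P

dividing-∣ : ∀ {p m} P → p ∣ m → dividing m (p ∷ P) ≡ p ∷ dividing m P
dividing-∣ {p} {m} P p∣m with p ∣? m
... | yes _  = refl
... | no p∤m = ⊥-elim (p∤m p∣m)

dividing-∤ : ∀ {p m} P → ¬ p ∣ m → dividing m (p ∷ P) ≡ dividing m P
dividing-∤ {p} {m} P p∤m with p ∣? m
... | yes p∣m = ⊥-elim (p∤m p∣m)
... | no _    = refl

avoids-∣ : ∀ {p m} P w → p ∣ m → avoids (p ∷ P) m w ≡ not (p ∣ᵇ w) ∧ avoids P m w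
avoids-∣ {p} {m} P w p∣m with p ∣? m
... | yes _  = refl
... | no p∤m = ⊥-elim (p∤m p∣m)

avoids-∤ : ∀ {p m} P w → ¬ p ∣ m → avoids (p ∷ P) m w ≡ avoids P m w
avoids-∤ {p} {m} P w p∤m with p ∣? m
... | yes p∣m = ⊥-elim (p∤m p∣m)
... | no _    = refl

dividing-skip : ∀ {p} P → All Prime P → All (p ≢_) P → Prime p → ∀ m → dividing (p * m) P ≡ dividing m P
dividing-skip []        _                  _               _       m = refl
dividing-skip (p' ∷ P) (p'-prime ∷ primes) (p≢p' ∷ p∉P) p-prime m
  = cong₂ (λ b D → if b then p' ∷ D else D) (∣ᵇ-skip m p'-prime p-prime (≢-sym p≢p')) (dividing-skip P primes p∉P p-prime m)

avoids-skip : ∀ {p} P → All Prime P → All (p ≢_) P → Prime p → ∀ m w → avoids P (p * m) (p * w) ≡ avoids P m w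
avoids-skip []        _                  _               _       m w = refl
avoids-skip (p' ∷ P) (p'-prime ∷ primes) (p≢p' ∷ p∉P) p-prime m w
  = cong₂ (λ b P-ok → b ∧ P-ok)
      (cong₂ (λ dm dw → not (dm ∧ dw)) (∣ᵇ-skip m p'-prime p-prime (≢-sym p≢p')) (∣ᵇ-skip w p'-prime p-prime (≢-sym p≢p')))
      (avoids-skip P primes p∉P p-prime m w)

count-split : ∀ n (h f : ℕ → Bool) → count n f ≡ count n (λ x → not (h x) ∧ f x) + count n (λ x → h x ∧ f x)
count-split n h f = trans (count-cong n by-cases) (count-disjoint n _ _ exclusive)
  where
  by-cases : ∀ x → x < n → f x ≡ ((not (h x) ∧ f x) ∨ (h x ∧ f x))
  by-cases x _ with h x | f x
  ... | true  | true  = refl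
  ... | true  | false = refl
  ... | false | true  = refl
  ... | false | false = refl
  exclusive : ∀ x → x < n → T (not (h x) ∧ f x) → T (h x ∧ f x) → ⊥
  exclusive x _ a b with h x
  ... | true  = a
  ... | false = b

-- the arithmetic of one step of the product formula: removing the multiples
-- of p = 1 + p' from a count over m' * p leaves a fraction p'/p
product-formula-arith : ∀ C₀ C₁ F F' m' p' → (C₀ + C₁) * F ≡ (suc p' * m') * F' → C₁ * F ≡ m' * F' →
  C₀ * (suc p' * F) ≡ (m' * suc p') * (p' * F')
product-formula-arith C₀ C₁ F F' m' p' total multiples = begin
    C₀ * (suc p' * F)       ≡⟨ regroup C₀ F p' ⟩
    suc p' * (C₀ * F)       ≡⟨ cong (suc p' *_) C₀F ⟩
    suc p' * (p' * m' * F') ≡⟨ regroup' m' F' p' ⟩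
    (m' * suc p') * (p' * F') ∎
  where
  open ≡-Reasoning
  regroup : ∀ C F p' → C * (suc p' * F) ≡ suc p' * (C * F)
  regroup = solve-∀
  regroup' : ∀ m' F' p' → suc p' * (p' * m' * F') ≡ (m' * suc p') * (p' * F')
  regroup' = solve-∀
  C₀F : C₀ * F ≡ p' * m' * F'
  C₀F = +-cancelʳ-≡ (m' * F') _ _ (begin
      C₀ * F + m' * F'          ≡⟨ cong (λ z → C₀ * F + z) (sym multiples) ⟩
      C₀ * F + C₁ * F           ≡⟨ sym (*-distribʳ-+ F C₀ C₁) ⟩
      (C₀ + C₁) * F             ≡⟨ total ⟩
      (suc p' * m') * F'        ≡⟨ expand m' F' p' ⟩
      p' * m' * F' + m' * F'    ∎)
    where
    expand : ∀ m' F' p' → (suc p' * m') * F' ≡ p' * m' * F' + m' * F'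
    expand = solve-∀

product-formula : ∀ P → All Prime P → Unique P → ∀ m →
  count m (avoids P m) * product (dividing m P) ≡ m * product (map pred (dividing m P))
product-formula [] _ _ m = trans (*-identityʳ _) (trans (count-all m) (sym (*-identityʳ m)))
product-formula (zero ∷ P) (0-prime ∷ _) _ m = ⊥-elim (<-irrefl refl (prime>0 0-prime))
product-formula (p@(suc p') ∷ P) (p-prime ∷ primes) (p∉P ∷ unique) m = by-cases (p ∣? m)
  where
  open ≡-Reasoning
  Formula : ℕ → Set
  Formula m = count m (avoids (p ∷ P) m) * product (dividing m (p ∷ P)) ≡ m * product (map pred (dividing m (p ∷ P)))
  -- for m = m' * p: the count splits into the non-multiples of p, which are
  -- the ones counted, and the multiples p * w, which avoid P iff w does
  multiple-of-p : ∀ m' → Formula (m' * p)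
  multiple-of-p m' = begin
      count M (avoids (p ∷ P) M) * product (dividing M (p ∷ P))
        ≡⟨ cong₂ _*_ (count-cong M (λ w _ → avoids-∣ P w p∣M)) (cong product (dividing-∣ P p∣M)) ⟩
      C₀ * (p * product (dividing M P))
        ≡⟨ cong (λ D → C₀ * (p * product D)) D≡ ⟩
      C₀ * (p * F)
        ≡⟨ product-formula-arith C₀ C₁ F F' m' p' total (product-formula P primes unique m') ⟩
      M * (p' * F')
        ≡⟨ cong (λ D → M * (p' * product (map pred D))) (sym D≡) ⟩
      M * (p' * product (map pred (dividing M P)))
        ≡⟨ cong (λ D → M * product (map pred D)) (sym (dividing-∣ P p∣M)) ⟩
      M * product (map pred (dividing M (p ∷ P))) ∎
    where
    M F F' C₀ C₁ : ℕ
    M  = m' * p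
    F  = product (dividing m' P)
    F' = product (map pred (dividing m' P))
    C₀ = count M (λ w → not (p ∣ᵇ w) ∧ avoids P M w)
    C₁ = count m' (avoids P m')
    M≡pm' : M ≡ p * m'
    M≡pm' = *-comm m' p
    p∣M : p ∣ M
    p∣M = n∣m*n m'
    D≡ : dividing M P ≡ dividing m' P
    D≡ = trans (cong (λ z → dividing z P) M≡pm') (dividing-skip P primes p∉P p-prime m')
    multiples : count M (λ w → p ∣ᵇ w ∧ avoids P M w) ≡ C₁
    multiples = begin
        count M (λ w → p ∣ᵇ w ∧ avoids P M w)
          ≡⟨ cong (λ z → count z (λ w → p ∣ᵇ w ∧ avoids P M w)) M≡pm' ⟩
        count (p * m') (λ w → p ∣ᵇ w ∧ avoids P M w)
          ≡⟨ count-multiples p' m' _ (λ x t → ∣ᵇ⇒∣ (proj₁ (Equivalence.to T-∧ t))) ⟩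
        count m' (λ w → p ∣ᵇ (p * w) ∧ avoids P M (p * w))
          ≡⟨ count-cong m' (λ w _ → cong₂ _∧_ (∣ᵇ-refl p w)
               (trans (cong (λ z → avoids P z (p * w)) M≡pm') (avoids-skip P primes p∉P p-prime m' w))) ⟩
        C₁ ∎
    total : (C₀ + C₁) * F ≡ (p * m') * F'
    total = begin
        (C₀ + C₁) * F                                     ≡⟨ cong (λ C → (C₀ + C) * F) (sym multiples) ⟩
        (C₀ + count M (λ w → p ∣ᵇ w ∧ avoids P M w)) * F  ≡⟨ cong (_* F) (sym (count-split M (p ∣ᵇ_) (avoids P M))) ⟩
        count M (avoids P M) * F                          ≡⟨ cong (λ D → count M (avoids P M) * product D) (sym D≡) ⟩
        count M (avoids P M) * product (dividing M P)     ≡⟨ product-formula P primes unique M ⟩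
        M * product (map pred (dividing M P))             ≡⟨ cong₂ (λ z D → z * product (map pred D)) M≡pm' D≡ ⟩
        (p * m') * F'                                     ∎
  by-cases : Dec (p ∣ m) → Formula m
  by-cases (yes (divides m' m≡m'p)) = subst Formula (sym m≡m'p) (multiple-of-p m')
  by-cases (no p∤m) = begin
      count m (avoids (p ∷ P) m) * product (dividing m (p ∷ P))
        ≡⟨ cong₂ _*_ (count-cong m (λ w _ → avoids-∤ P w p∤m)) (cong product (dividing-∤ P p∤m)) ⟩
      count m (avoids P m) * product (dividing m P)
        ≡⟨ product-formula P primes unique m ⟩
      m * product (map pred (dividing m P))
        ≡⟨ cong (λ D → m * product (map pred D)) (sym (dividing-∤ P p∤m)) ⟩
      m * product (map pred (dividing m (p ∷ P))) ∎

-- Completing both products over all of P only helps the lower bound, as p - 1 ≤ p.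
complete-products : ∀ P m x y → x * product (dividing m P) ≡ y * product (map pred (dividing m P)) →
  y * product (map pred P) ≤ x * product P
complete-products []      m x y eq = ≤-reflexive (sym eq)
complete-products (p ∷ P) m x y eq with p ∣? m
... | yes p∣m = begin
    y * (pred p * product (map pred P))  ≡⟨ sym (*-assoc y (pred p) _) ⟩
    (y * pred p) * product (map pred P)  ≤⟨ complete-products P m (x * p) (y * pred p) eq' ⟩
    (x * p) * product P                  ≡⟨ *-assoc x p _ ⟩
    x * (p * product P)                  ∎
  where
  open ≤-Reasoning
  eq' : (x * p) * product (dividing m P) ≡ (y * pred p) * product (map pred (dividing m P))
  eq' = trans (*-assoc x p _) (trans eq (sym (*-assoc y (pred p) _)))
... | no p∤m = begin
    y * (pred p * product (map pred P))  ≡⟨ *-swap y (pred p) _ ⟩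
    pred p * (y * product (map pred P))  ≤⟨ *-mono-≤ (pred[n]≤n {p}) (complete-products P m x y eq) ⟩
    p * (x * product P)                  ≡⟨ *-swap p x _ ⟩
    x * (p * product P)                  ∎
  where
  open ≤-Reasoning
  *-swap : ∀ a b c → a * (b * c) ≡ b * (a * c)
  *-swap = solve-∀

avoid-density : ∀ P → All Prime P → Unique P → ∀ m → m * product (map pred P) ≤ count m (avoids P m) * product P
avoid-density P primes unique m = complete-products P m (count m (avoids P m)) m (product-formula P primes unique m)

-- Units: counting residues coprime to m

unit : ℕ → ℕ → Bool
unit m w = gcd w m ≡ᵇ 1

unit⇒avoids : ∀ P → All Prime P → ∀ m w → T (unit m w) → T (avoids P m w)
unit⇒avoids []      _                  m w _ = tt
unit⇒avoids (p ∷ P) (p-prime ∷ primes) m w w-unit =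
  Equivalence.from T-∧ (p-not-common , unit⇒avoids P primes m w w-unit)
  where
  gcd≡1 : gcd w m ≡ 1
  gcd≡1 = ≡ᵇ⇒≡ (gcd w m) 1 w-unit
  p-not-common : T (not (p ∣ᵇ m ∧ p ∣ᵇ w))
  p-not-common with p ∣? m | p ∣? w
  ... | yes p∣m | yes p∣w = <-irrefl (sym (∣1⇒≡1 (subst (p ∣_) gcd≡1 (gcd-greatest p∣w p∣m)))) (prime>1 p-prime)
  ... | yes _   | no _    = tt
  ... | no _    | _       = tt

-- φ counts the units among 0, …, m - 1 (0 and m are never units once m > 1)
φ≡count-units : ∀ m → 1 < m → φ m ≡ count m (unit m)
φ≡count-units m 1<m = begin
    φ m                                   ≡⟨ length-filter-map (upTo m) ⟩
    length (filterᵇ (unit m ∘ suc) (upTo m)) ≡⟨ length-filter-upTo m (unit m ∘ suc) ⟩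
    count m (unit m ∘ suc)                ≡⟨ cong (_+ count m (unit m ∘ suc)) (sym (non-unit 0 (gcd-identityˡ m))) ⟩
    indicator (unit m 0) + count m (unit m ∘ suc) ≡⟨ sym (count-+ 1 m (unit m)) ⟩
    count (suc m) (unit m)                ≡⟨ cong (_+_ (count m (unit m))) (non-unit m gcd-idem) ⟩
    count m (unit m) + 0                  ≡⟨ +-identityʳ _ ⟩
    count m (unit m)                      ∎
  where
  open ≡-Reasoning
  length-filter-map : ∀ xs → length (filterᵇ (unit m) (map suc xs)) ≡ length (filterᵇ (unit m ∘ suc) xs)
  length-filter-map []       = refl
  length-filter-map (x ∷ xs) with unit m (suc x)
  ... | true  = cong suc (length-filter-map xs)
  ... | false = length-filter-map xs
  gcd-idem : gcd m m ≡ m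
  gcd-idem = GCD.unique (gcd-GCD m m) GCD.refl
  non-unit : ∀ w → gcd w m ≡ m → indicator (unit m w) ≡ 0
  non-unit w gcd≡m with unit m w in e
  ... | true  = ⊥-elim (<-irrefl (trans (sym (≡ᵇ⇒≡ _ 1 (subst T (sym e) tt))) gcd≡m) 1<m)
  ... | false = refl

φ-two-primes : ∀ {r s} → Prime r → Prime s → r ≢ s → φ (r * s) ≤ pred r * pred s
φ-two-primes {r} {s} r-prime s-prime r≢s = begin
    φ (r * s)                         ≡⟨ φ≡count-units (r * s) 1<rs ⟩
    count (r * s) (unit (r * s))      ≤⟨ count-mono (r * s) (λ w _ → unit⇒avoids P (r-prime ∷ s-prime ∷ []) (r * s) w) ⟩
    count (r * s) (avoids P (r * s))  ≡⟨ *-cancelʳ-≡ _ _ (r * (s * 1)) {{>-nonZero 0<rs*1}} exact ⟩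
    pred r * pred s                   ∎
  where
  open ≤-Reasoning
  P : List ℕ
  P = r ∷ s ∷ []
  1<rs : 1 < r * s
  1<rs = ≤-trans (prime>1 r-prime) (m≤m*n r s {{>-nonZero (prime>0 s-prime)}})
  0<rs*1 : 0 < r * (s * 1)
  0<rs*1 = subst (λ z → 0 < r * z) (sym (*-identityʳ s)) (<-trans (s≤s z≤n) 1<rs)
  dividing≡P : dividing (r * s) P ≡ P
  dividing≡P = trans (dividing-∣ (s ∷ []) (m∣m*n s)) (cong (r ∷_) (dividing-∣ [] (n∣m*n r)))
  exact : count (r * s) (avoids P (r * s)) * (r * (s * 1)) ≡ (pred r * pred s) * (r * (s * 1))
  exact = begin-equality
      count (r * s) (avoids P (r * s)) * product P                   ≡⟨ cong (λ D → count (r * s) (avoids P (r * s)) * product D) (sym dividing≡P) ⟩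
      count (r * s) (avoids P (r * s)) * product (dividing (r * s) P) ≡⟨ product-formula P (r-prime ∷ s-prime ∷ []) ((r≢s ∷ []) ∷ [] ∷ []) (r * s) ⟩
      (r * s) * product (map pred (dividing (r * s) P))               ≡⟨ cong (λ D → (r * s) * product (map pred D)) dividing≡P ⟩
      (r * s) * (pred r * (pred s * 1))                              ≡⟨ rearrange r s (pred r) (pred s) ⟩
      (pred r * pred s) * (r * (s * 1))                              ∎
    where
    rearrange : ∀ a b c d → (a * b) * (c * (d * 1)) ≡ (c * d) * (a * (b * 1))
    rearrange = solve-∀

-- the residues y < d·m with gcd(y, d·m) = d are the d·w for units w of ℤ_m
count-gcd-class : ∀ d m → 0 < d → count (d * m) (λ y → gcd y (d * m) ≡ᵇ d) ≡ count m (unit m)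
count-gcd-class d@(suc d') m _ = begin
    count (d * m) (λ y → gcd y (d * m) ≡ᵇ d)           ≡⟨ count-multiples d' m _ only-multiples ⟩
    count m (λ w → gcd (d * w) (d * m) ≡ᵇ d)           ≡⟨ count-cong m (λ w _ → scaled-unit w) ⟩
    count m (unit m)                                   ∎
  where
  open ≡-Reasoning
  only-multiples : ∀ y → T (gcd y (d * m) ≡ᵇ d) → d ∣ y
  only-multiples y t = subst (_∣ y) (≡ᵇ⇒≡ _ _ t) (gcd[m,n]∣m y (d * m))
  scaled-unit : ∀ w → (gcd (d * w) (d * m) ≡ᵇ d) ≡ unit m w
  scaled-unit w = begin
      (gcd (d * w) (d * m) ≡ᵇ d)   ≡⟨ cong₂ _≡ᵇ_ (sym (c*gcd[m,n]≡gcd[cm,cn] d w m)) (sym (*-identityʳ d)) ⟩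
      (d * gcd w m ≡ᵇ d * 1)       ≡⟨ ≡ᵇ-cong (*-cancelˡ-≡ (gcd w m) 1 d) (cong (d *_)) ⟩
      unit m w                     ∎

-- Powers in the cyclic group ℤ_N, N = suc n'

*-%-congʳ : ∀ n' t {a b} → a % suc n' ≡ b % suc n' → (t * a) % suc n' ≡ (t * b) % suc n'
*-%-congʳ n' t {a} {b} a≡b = begin
    (t * a) % N                  ≡⟨ %-distribˡ-* t a N ⟩
    ((t % N) * (a % N)) % N      ≡⟨ cong (λ z → ((t % N) * z) % N) a≡b ⟩
    ((t % N) * (b % N)) % N      ≡⟨ %-distribˡ-* t b N ⟨
    (t * b) % N                  ∎
  where
  open ≡-Reasoning
  N : ℕ
  N = suc n'

isPowerOf-sound : ∀ n' x y → T (isPowerOf (suc n') x y) → ∃ λ k → (k * y) % suc n' ≡ x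
isPowerOf-sound n' x y t with satisfied (any⁻ _ (upTo (suc n')) t)
... | k , k*y≡x = k , ≡ᵇ⇒≡ _ _ k*y≡x

isPowerOf-complete : ∀ n' x y k → (k * y) % suc n' ≡ x → T (isPowerOf (suc n') x y)
isPowerOf-complete n' x y k k*y≡x =
  any⁺ _ (lose (∈-upTo⁺ (m%n<n k N)) (≡⇒≡ᵇ _ _ (trans reduced k*y≡x)))
  where
  N : ℕ
  N = suc n'
  reduced : ((k % N) * y) % N ≡ (k * y) % N
  reduced = begin
      ((k % N) * y) % N   ≡⟨ cong (_% N) (*-comm (k % N) y) ⟩
      (y * (k % N)) % N   ≡⟨ *-%-congʳ n' y (m%n%n≡m%n k N) ⟩
      (y * k) % N         ≡⟨ cong (_% N) (*-comm y k) ⟩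
      (k * y) % N         ∎
    where open ≡-Reasoning

power⇒gcd∣ : ∀ n' x y → T (isPowerOf (suc n') x y) → gcd y (suc n') ∣ x
power⇒gcd∣ n' x y t with isPowerOf-sound n' x y t
... | k , refl = %-presˡ-∣ (∣n⇒∣m*n k (gcd[m,n]∣m y N)) (gcd[m,n]∣n y N)
  where
  N : ℕ
  N = suc n'

-- by Bézout, gcd(y, N) is itself a multiple of y modulo N
gcd-is-power : ∀ n' y → ∃ λ k → (k * y) % suc n' ≡ gcd y (suc n') % suc n'
gcd-is-power n' y with Bézout.identity (gcd-GCD y (suc n'))
... | Bézout.Identity.+- a b G+bN≡ay = a , (begin
    (a * y) % N            ≡⟨ cong (_% N) (sym G+bN≡ay) ⟩
    (G + b * N) % N        ≡⟨ [m+kn]%n≡m%n G b N ⟩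
    G % N                  ∎)
  where
  open ≡-Reasoning
  N : ℕ
  N = suc n'
  G : ℕ
  G = gcd y N
... | Bézout.Identity.-+ a b G+ay≡bN = n' * a , (begin
    (n' * a * y) % N            ≡⟨ [m+kn]%n≡m%n (n' * a * y) b N ⟨
    (n' * a * y + b * N) % N    ≡⟨ cong (λ z → (n' * a * y + z) % N) (sym G+ay≡bN) ⟩
    (n' * a * y + (G + a * y)) % N ≡⟨ cong (_% N) (collect n' a y G) ⟩
    (G + (a * y) * N) % N       ≡⟨ [m+kn]%n≡m%n G (a * y) N ⟩
    G % N                       ∎)
  where
  open ≡-Reasoning
  N : ℕ
  N = suc n'
  G : ℕ
  G = gcd y N
  collect : ∀ n' a y G → n' * a * y + (G + a * y) ≡ G + (a * y) * suc n'
  collect = solve-∀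

gcd∣⇒power : ∀ n' x y → x < suc n' → gcd y (suc n') ∣ x → T (isPowerOf (suc n') x y)
gcd∣⇒power n' x y x<N (divides t refl) with gcd-is-power n' y
... | k , ky≡G = isPowerOf-complete n' _ y (t * k) (begin
    (t * k * y) % N           ≡⟨ cong (_% N) (*-assoc t k y) ⟩
    (t * (k * y)) % N         ≡⟨ *-%-congʳ n' t ky≡G ⟩
    (t * gcd y N) % N         ≡⟨ m<n⇒m%n≡m x<N ⟩
    t * gcd y N               ∎)
  where
  open ≡-Reasoning
  N : ℕ
  N = suc n'

-- Degrees in the power graph of ℤ_N

adjacent-irrefl : ∀ n a → ¬ T (adjacent n a a)
adjacent-irrefl n a t = subst (λ b → T (not b ∧ (isPowerOf n a a ∨ isPowerOf n a a))) (≡ᵇ-refl a) t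

adjacent-intro : ∀ n a b → a ≢ b → T (isPowerOf n a b ∨ isPowerOf n b a) → T (adjacent n a b)
adjacent-intro n a b a≢b power = Equivalence.from T-∧ (distinct , power)
  where
  distinct : T (not (a ≡ᵇ b))
  distinct with a ≡ᵇ b in e
  ... | true  = a≢b (≡ᵇ⇒≡ a b (subst T (sym e) tt))
  ... | false = tt

adjacent-elim : ∀ n a b → T (adjacent n a b) → T (isPowerOf n a b ∨ isPowerOf n b a)
adjacent-elim n a b t = proj₂ (Equivalence.to (T-∧ {not (a ≡ᵇ b)}) t)

closed-degree : ∀ n' a → a < suc n' → deg (suc n') a + 1 ≡ count (suc n') (λ y → adjacent (suc n') a y ∨ (y ≡ᵇ a))
closed-degree n' a a<N = begin
    deg N a + 1                                          ≡⟨ cong₂ _+_ (length-filter-upTo N _) (sym (count-point N a a<N)) ⟩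
    count N (adjacent N (a % N)) + count N (λ y → y ≡ᵇ a) ≡⟨ cong (λ b → count N (adjacent N b) + count N (λ y → y ≡ᵇ a)) (m<n⇒m%n≡m a<N) ⟩
    count N (adjacent N a) + count N (λ y → y ≡ᵇ a)       ≡⟨ count-disjoint N _ _ not-self ⟨
    count N (λ y → adjacent N a y ∨ (y ≡ᵇ a))            ∎
  where
  open ≡-Reasoning
  N : ℕ
  N = suc n'
  not-self : ∀ y → y < N → T (adjacent N a y) → T (y ≡ᵇ a) → ⊥
  not-self y _ adj y≡a with ≡ᵇ⇒≡ y a y≡a
  ... | refl = adjacent-irrefl N a adj

factor>0 : ∀ {g m n'} → g * m ≡ suc n' → 0 < g
factor>0 {zero} ()
factor>0 {suc g} _ = s≤s z≤n

-- Upper bound at a prime vertex r ∣ N, N = r·m: if r is a power of y then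
-- gcd(y, N) ∣ r is 1 or r, so the neighbours of r are units or multiples of r.
degree-prime-≤ : ∀ n' r m → Prime r → r * m ≡ suc n' → r < suc n' →
  deg (suc n') r + 1 ≤ m + count (suc n') (unit (suc n'))
degree-prime-≤ n' r m r-prime rm≡N r<N = begin
    deg N r + 1                                   ≡⟨ closed-degree n' r r<N ⟩
    count N (λ y → adjacent N r y ∨ (y ≡ᵇ r))      ≤⟨ count-mono N neighbour ⟩
    count N (λ y → r ∣ᵇ y ∨ unit N y)             ≤⟨ count-∨-≤ N _ _ ⟩
    count N (r ∣ᵇ_) + count N (unit N)            ≡⟨ cong (λ z → count z (r ∣ᵇ_) + count N (unit N)) (sym rm≡N) ⟩
    count (r * m) (r ∣ᵇ_) + count N (unit N)      ≡⟨ cong (_+ count N (unit N)) (count-divisible r m (prime>0 r-prime)) ⟩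
    m + count N (unit N)                          ∎
  where
  open ≤-Reasoning
  N : ℕ
  N = suc n'
  r∣N : r ∣ N
  r∣N = subst (r ∣_) rm≡N (m∣m*n m)
  neighbour : ∀ y → y < N → T (adjacent N r y ∨ (y ≡ᵇ r)) → T (r ∣ᵇ y ∨ unit N y)
  neighbour y _ t with T∨-elim {adjacent N r y} t
  ... | inj₂ y≡r = T∨ˡ (∣⇒∣ᵇ (subst (r ∣_) (sym (≡ᵇ⇒≡ y r y≡r)) ∣-refl))
  ... | inj₁ adj with T∨-elim {isPowerOf N r y} (adjacent-elim N r y adj)
  ...   | inj₂ y-power-of-r = T∨ˡ (∣⇒∣ᵇ (∣-trans (gcd-greatest ∣-refl r∣N) (power⇒gcd∣ n' y r y-power-of-r)))
  ...   | inj₁ r-power-of-y with prime⇒irreducible r-prime (power⇒gcd∣ n' r y r-power-of-y)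
  ...     | inj₁ gcd≡1 = T∨ʳ {r ∣ᵇ y} (≡⇒≡ᵇ _ 1 gcd≡1)
  ...     | inj₂ gcd≡r = T∨ˡ (∣⇒∣ᵇ (subst (_∣ y) gcd≡r (gcd[m,n]∣m y N)))

-- Lower bound at a divisor g of N, N = g·m: the multiples of g are powers of g,
-- and g is a power of every y with gcd(y, N) ∣ g.  Any family D of residues
-- whose gcd with N is a proper divisor of g is disjoint from the multiples.
degree-divisor-≥ : ∀ n' g m → g * m ≡ suc n' → g < suc n' → (D : ℕ → Bool) →
  (∀ y → T (D y) → gcd y (suc n') ∣ g × gcd y (suc n') < g) →
  m + count (suc n') D ≤ deg (suc n') g + 1
degree-divisor-≥ n' g m gm≡N g<N D proper = begin
    m + count N D                                  ≡⟨ cong (_+ count N D) (sym (count-divisible g m (factor>0 gm≡N))) ⟩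
    count (g * m) (g ∣ᵇ_) + count N D              ≡⟨ cong (λ z → count z (g ∣ᵇ_) + count N D) gm≡N ⟩
    count N (g ∣ᵇ_) + count N D                    ≡⟨ count-disjoint N _ _ disjoint ⟨
    count N (λ y → g ∣ᵇ y ∨ D y)                   ≤⟨ count-mono N neighbour ⟩
    count N (λ y → adjacent N g y ∨ (y ≡ᵇ g))      ≡⟨ closed-degree n' g g<N ⟨
    deg N g + 1                                    ∎
  where
  open ≤-Reasoning
  N : ℕ
  N = suc n'
  g∣N : g ∣ N
  g∣N = subst (g ∣_) gm≡N (m∣m*n m)
  disjoint : ∀ y → y < N → T (g ∣ᵇ y) → T (D y) → ⊥
  disjoint y _ g∣y Dy = <-irrefl refl (<-≤-trans (proj₂ (proper y Dy)) (∣⇒≤ {{gcd≢0}} (gcd-greatest (∣ᵇ⇒∣ g∣y) g∣N)))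
    where
    gcd≢0 : NonZero (gcd y N)
    gcd≢0 = ≢-nonZero (gcd[m,n]≢0 y N (inj₂ (λ ())))
  neighbour : ∀ y → y < N → T (g ∣ᵇ y ∨ D y) → T (adjacent N g y ∨ (y ≡ᵇ g))
  neighbour y y<N t with y ≟ g
  ... | yes refl = T∨ʳ {adjacent N g g} (≡⇒≡ᵇ g g refl)
  ... | no y≢g = T∨ˡ (adjacent-intro N g y (≢-sym y≢g) power)
    where
    power : T (isPowerOf N g y ∨ isPowerOf N y g)
    power with T∨-elim {g ∣ᵇ y} t
    ... | inj₂ Dy = T∨ˡ (gcd∣⇒power n' g y g<N (proj₁ (proper y Dy)))
    ... | inj₁ g∣y with ∣ᵇ⇒∣ g∣y
    ...   | divides k refl = T∨ʳ {isPowerOf N g y} (isPowerOf-complete n' _ g k (m<n⇒m%n≡m y<N))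

telescope : (M L : ℕ → ℕ) (A : ℕ) →
  (∀ c t → suc c + t ≡ A → M (suc t) + L c < M t + L (suc c)) →
  ∀ c t → suc c + t ≡ A → M A + L 0 < M t + L (suc c)
telescope M L A step zero    t e = subst (λ a → M a + L 0 < M t + L 1) e (step zero t e)
telescope M L A step (suc c) t e =
  <-trans (telescope M L A step c (suc t) (trans (+-suc (suc c) t) e)) (step (suc c) t e)

layer-arith : ∀ q r s m X Y → 0 < m → 1 < q → q * r * s < (q + r) * (pred r * pred s) →
  (m * r) * (pred q * (pred r * (pred s * 1))) ≤ X * (q * (r * (s * 1))) →
  (m * q) * (pred q * (pred r * (pred s * 1))) ≤ Y * (q * (r * (s * 1))) →
  pred q * m < X + Y
layer-arith q r s m X Y 0<m 1<q hyp X-bound Y-bound = *-cancelʳ-< Π _ _ (begin-strict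
    (pred q * m) * Π                                  ≡⟨ reassoc (pred q * m) q r s ⟩
    (pred q * m) * (q * r * s)                        <⟨ *-monoʳ-< (pred q * m) {{>-nonZero (*-mono-≤ (pred-mono-≤ 1<q) 0<m)}} hyp ⟩
    (pred q * m) * ((q + r) * (pred r * pred s))      ≡⟨ distribute (pred q) m q r (pred r) (pred s) ⟩
    (m * r) * Φ + (m * q) * Φ                         ≤⟨ +-mono-≤ X-bound Y-bound ⟩
    X * Π + Y * Π                                     ≡⟨ *-distribʳ-+ Π X Y ⟨
    (X + Y) * Π                                       ∎)
  where
  open ≤-Reasoning
  Φ Π : ℕ
  Φ = pred q * (pred r * (pred s * 1))
  Π = q * (r * (s * 1))
  reassoc : ∀ a q r s → a * (q * (r * (s * 1))) ≡ a * (q * r * s)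
  reassoc = solve-∀
  distribute : ∀ q' m q r r' s' → (q' * m) * ((q + r) * (r' * s')) ≡ (m * r) * (q' * (r' * (s' * 1))) + (m * q) * (q' * (r' * (s' * 1)))
  distribute = solve-∀

avoids-prime-power : ∀ {p m w} k → Prime p → p ^ k ∣ m → T (not (p ∣ᵇ m ∧ p ∣ᵇ w)) → Coprime w (p ^ k)
avoids-prime-power zero    _       _     _ (_ , i∣1) = ∣1⇒≡1 i∣1
avoids-prime-power {p} {m} {w} (suc k) p-prime p^k∣m avoid = coprime-^ (suc k) (coprime-prime p-prime p∤w)
  where
  p∤w : ¬ p ∣ w
  p∤w p∣w with p ∣? m | p ∣? w
  ... | yes _   | yes _   = avoid
  ... | yes _   | no p∤w' = p∤w' p∣w
  ... | no p∤m  | _       = p∤m (∣-trans (m∣m*n (p ^ k)) p^k∣m)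

-- Vertex r has degree < N/r + φ(N); vertex g = q^β r has degree ≥ N/g + φ(N)
-- plus the number of residues whose gcd with N is q^a (1 ≤ a ≤ β) or q^a r
-- (a < β).  Each such pair of gcd-classes outnumbers one step
-- N/(q^(β-a) r) - N/(q^(β-a-1) r) = (q-1)·M, and these steps telescope to N/r - N/g.
module ThreePrimes (q r s A B' C' n' : ℕ) (q-prime : Prime q) (r-prime : Prime r) (s-prime : Prime s)
                   (q≢r : q ≢ r) (q≢s : q ≢ s) (r≢s : r ≢ s)
                   (factorisation : q ^ A * r ^ suc B' * s ^ suc C' ≡ suc n') where

  N C : ℕ
  N = suc n'
  C = suc C'

  P₃ : List ℕ
  P₃ = q ∷ r ∷ s ∷ []

  q>0 : 0 < q
  q>0 = prime>0 q-prime

  q^>0 : ∀ a → 0 < q ^ a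
  q^>0 a = m^n>0 q {{>-nonZero q>0}} a

  -- the cofactor N / (q^(A - t) · r)
  M : ℕ → ℕ
  M t = q ^ t * r ^ B' * s ^ C

  1<M : ∀ t → 1 < M t
  1<M t = ≤-trans (prime>1 s-prime) (≤-trans (m≤m*n s (s ^ C') {{m^n≢0 s C' {{>-nonZero (prime>0 s-prime)}}}})
                                            (m≤n*m (s ^ C) (q ^ t * r ^ B') {{>-nonZero q^t*r^B'>0}}))
    where
    q^t*r^B'>0 : 0 < q ^ t * r ^ B'
    q^t*r^B'>0 = *-mono-≤ (q^>0 t) (m^n>0 r {{>-nonZero (prime>0 r-prime)}} B')

  N≡ : ∀ {c t} → suc c + t ≡ A → N ≡ q ^ suc c * q ^ t * r ^ suc B' * s ^ C
  N≡ {c} {t} e = trans (sym factorisation)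
                   (cong (λ z → z * r ^ suc B' * s ^ C) (trans (cong (q ^_) (sym e)) (^-distribˡ-+-* q (suc c) t)))

  r·M≡N : r * M A ≡ N
  r·M≡N = trans (regroup r (q ^ A) (r ^ B') (s ^ C)) factorisation
    where
    regroup : ∀ r x y z → r * (x * y * z) ≡ x * (r * y) * z
    regroup = solve-∀

  cofactor-q : ∀ {c t} → suc c + t ≡ A → q ^ suc c * (M t * r) ≡ N
  cofactor-q {c} {t} e = trans (regroup r (q ^ suc c) (q ^ t) (r ^ B') (s ^ C)) (sym (N≡ {c} {t} e))
    where
    regroup : ∀ r x u y z → x * ((u * y * z) * r) ≡ x * u * (r * y) * z
    regroup = solve-∀

  cofactor-qr : ∀ {c t} → suc c + t ≡ A → (q ^ c * r) * (M t * q) ≡ N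
  cofactor-qr {c} {t} e = trans (regroup q r (q ^ c) (q ^ t) (r ^ B') (s ^ C)) (sym (N≡ {c} {t} e))
    where
    regroup : ∀ q r x u y z → (x * r) * ((u * y * z) * q) ≡ q * x * u * (r * y) * z
    regroup = solve-∀

  cofactor-g : ∀ {c t} → suc c + t ≡ A → (q ^ suc c * r) * M t ≡ N
  cofactor-g {c} {t} e = trans (regroup r (q ^ suc c) (q ^ t) (r ^ B') (s ^ C)) (sym (N≡ {c} {t} e))
    where
    regroup : ∀ r x u y z → (x * r) * (u * y * z) ≡ x * u * (r * y) * z
    regroup = solve-∀

  q^-injective : ∀ {a b} → q ^ a ≡ q ^ b → a ≡ b
  q^-injective {a} {b} e with <-cmp a b
  ... | tri< a<b _ _ = ⊥-elim (<-irrefl e (^-monoʳ-< q (prime>1 q-prime) a<b))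
  ... | tri≈ _ a≡b _ = a≡b
  ... | tri> _ _ a>b = ⊥-elim (<-irrefl (sym e) (^-monoʳ-< q (prime>1 q-prime) a>b))

  q^r-injective : ∀ {a b} → q ^ a * r ≡ q ^ b * r → a ≡ b
  q^r-injective e = q^-injective (*-cancelʳ-≡ _ _ r {{>-nonZero (prime>0 r-prime)}} e)

  q^≢q^r : ∀ a b → q ^ a ≢ q ^ b * r
  q^≢q^r a b e = q≢r (sym (prime∣prime r-prime q-prime (prime∣^ a r-prime (subst (r ∣_) (sym e) (n∣m*n (q ^ b))))))

  has-gcd : ℕ → ℕ → Bool
  has-gcd d y = gcd y N ≡ᵇ d

  has-gcd⇒ : ∀ {d} y → T (has-gcd d y) → gcd y N ≡ d
  has-gcd⇒ {d} y = ≡ᵇ⇒≡ (gcd y N) d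

  layers : ℕ → ℕ → Bool
  layers zero    y = false
  layers (suc c) y = layers c y ∨ (has-gcd (q ^ suc c) y ∨ has-gcd (q ^ c * r) y)

  layers-gcd : ∀ c y → T (layers c y) →
    (∃ λ a → 1 ≤ a × a ≤ c × gcd y N ≡ q ^ a) ⊎ (∃ λ a → a < c × gcd y N ≡ q ^ a * r)
  layers-gcd (suc c) y t with T∨-elim {layers c y} t
  ... | inj₁ lower with layers-gcd c y lower
  ...   | inj₁ (a , 1≤a , a≤c , eq) = inj₁ (a , 1≤a , m≤n⇒m≤1+n a≤c , eq)
  ...   | inj₂ (a , a<c , eq)       = inj₂ (a , m<n⇒m<1+n a<c , eq)
  layers-gcd (suc c) y t | inj₂ top with T∨-elim {has-gcd (q ^ suc c) y} top
  ...   | inj₁ gcd≡q^c+1 = inj₁ (suc c , s≤s z≤n , ≤-refl , has-gcd⇒ y gcd≡q^c+1)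
  ...   | inj₂ gcd≡q^cr  = inj₂ (c , ≤-refl , has-gcd⇒ y gcd≡q^cr)

  count-layers : ∀ c → count N (layers (suc c)) ≡
    count N (layers c) + (count N (has-gcd (q ^ suc c)) + count N (has-gcd (q ^ c * r)))
  count-layers c = trans (count-disjoint N (layers c) _ new-layer)
                         (cong (_+_ (count N (layers c))) (count-disjoint N _ _ q^≠q^r))
    where
    q^≠q^r : ∀ y → y < N → T (has-gcd (q ^ suc c) y) → T (has-gcd (q ^ c * r) y) → ⊥
    q^≠q^r y _ t₁ t₂ = q^≢q^r (suc c) c (trans (sym (has-gcd⇒ y t₁)) (has-gcd⇒ y t₂))
    new-layer : ∀ y → y < N → T (layers c y) → T (has-gcd (q ^ suc c) y ∨ has-gcd (q ^ c * r) y) → ⊥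
    new-layer y _ t₁ t₂ with layers-gcd c y t₁ | T∨-elim {has-gcd (q ^ suc c) y} t₂
    ... | inj₁ (a , _ , a≤c , e) | inj₁ t = <-irrefl (q^-injective (trans (sym e) (has-gcd⇒ y t))) (s≤s a≤c)
    ... | inj₁ (a , _ , _ , e)   | inj₂ t = q^≢q^r a c (trans (sym e) (has-gcd⇒ y t))
    ... | inj₂ (a , _ , e)       | inj₁ t = q^≢q^r (suc c) a (trans (sym (has-gcd⇒ y t)) e)
    ... | inj₂ (a , a<c , e)     | inj₂ t = <-irrefl (q^r-injective (trans (sym e) (has-gcd⇒ y t))) a<c

  avoids⇒unit : ∀ a b e w → T (avoids P₃ (q ^ a * r ^ b * s ^ e) w) → T (unit (q ^ a * r ^ b * s ^ e) w)
  avoids⇒unit a b e w t = ≡⇒≡ᵇ _ 1 (coprime⇒gcd≡1 (coprime-* (coprime-* q-part r-part) s-part))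
    where
    m : ℕ
    m = q ^ a * r ^ b * s ^ e
    avoids-prime : ℕ → Bool
    avoids-prime p = not (p ∣ᵇ m ∧ p ∣ᵇ w)
    avoid-q : T (avoids-prime q)
    avoid-q = proj₁ (Equivalence.to T-∧ t)
    avoid-r : T (avoids-prime r)
    avoid-r = proj₁ (Equivalence.to T-∧ (proj₂ (Equivalence.to (T-∧ {avoids-prime q}) t)))
    avoid-s : T (avoids-prime s)
    avoid-s = proj₁ (Equivalence.to T-∧ (proj₂ (Equivalence.to (T-∧ {avoids-prime r})
                (proj₂ (Equivalence.to (T-∧ {avoids-prime q}) t)))))
    q-part : Coprime w (q ^ a)
    q-part = avoids-prime-power a q-prime (∣m⇒∣m*n (s ^ e) (m∣m*n (r ^ b))) avoid-q
    r-part : Coprime w (r ^ b)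
    r-part = avoids-prime-power b r-prime (∣m⇒∣m*n (s ^ e) (n∣m*n (q ^ a))) avoid-r
    s-part : Coprime w (s ^ e)
    s-part = avoids-prime-power e s-prime (n∣m*n (q ^ a * r ^ b)) avoid-s

  gcd-class-bound : ∀ d m a b e → 0 < d → m ≡ q ^ a * r ^ b * s ^ e → d * m ≡ N →
    m * product (map pred P₃) ≤ count N (has-gcd d) * product P₃
  gcd-class-bound d m a b e 0<d refl dm≡N = begin
      m * product (map pred P₃)                     ≤⟨ avoid-density P₃ primes distinct m ⟩
      count m (avoids P₃ m) * product P₃            ≤⟨ *-monoˡ-≤ (product P₃) (count-mono m (λ w _ → avoids⇒unit a b e w)) ⟩
      count m (unit m) * product P₃                 ≡⟨ cong (_* product P₃) (sym (count-gcd-class d m 0<d)) ⟩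
      count (d * m) (λ y → gcd y (d * m) ≡ᵇ d) * product P₃ ≡⟨ cong (λ z → count z (λ y → gcd y z ≡ᵇ d) * product P₃) dm≡N ⟩
      count N (has-gcd d) * product P₃              ∎
    where
    open ≤-Reasoning
    primes : All Prime P₃
    primes = q-prime ∷ r-prime ∷ s-prime ∷ []
    distinct : Unique P₃
    distinct = (q≢r ∷ q≢s ∷ []) ∷ (r≢s ∷ []) ∷ [] ∷ []

  proper-divisor : ∀ c y → T (unit N y ∨ layers (suc c) y) → gcd y N ∣ q ^ suc c * r × gcd y N < q ^ suc c * r
  proper-divisor c y t with T∨-elim {unit N y} t
  ... | inj₁ y-unit rewrite has-gcd⇒ y y-unit =
        1∣ _ , ≤-trans (prime>1 r-prime) (m≤n*m r (q ^ suc c) {{>-nonZero (q^>0 (suc c))}})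
  ... | inj₂ layer with layers-gcd (suc c) y layer
  ...   | inj₁ (a , _ , a≤1+c , gcd≡q^a) rewrite gcd≡q^a =
          ∣m⇒∣m*n r (^-∣ q a≤1+c) ,
          ≤-<-trans (^-monoʳ-≤ q {{>-nonZero q>0}} a≤1+c) (m<m*n (q ^ suc c) r {{>-nonZero (q^>0 (suc c))}} (prime>1 r-prime))
  ...   | inj₂ (a , a<1+c , gcd≡q^ar) rewrite gcd≡q^ar =
          *-monoˡ-∣ r (^-∣ q (<⇒≤ a<1+c)) ,
          *-monoˡ-< r {{>-nonZero (prime>0 r-prime)}} (^-monoʳ-< q (prime>1 q-prime) a<1+c)

  count-units-and-layers : ∀ c → count N (unit N) + count N (layers c) ≡ count N (λ y → unit N y ∨ layers c y)
  count-units-and-layers c = sym (count-disjoint N _ _ apart)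
    where
    apart : ∀ y → y < N → T (unit N y) → T (layers c y) → ⊥
    apart y _ y-unit layer with layers-gcd c y layer
    ... | inj₁ (a , 1≤a , _ , e) = <-irrefl (q^-injective {0} {a} (trans (sym (has-gcd⇒ y y-unit)) e)) 1≤a
    ... | inj₂ (a , _ , e)       = q^≢q^r 0 a (trans (sym (has-gcd⇒ y y-unit)) e)

  L : ℕ → ℕ
  L c = count N (layers c)

  module _ (totient-hypothesis : q * r * s < (q + r) * (pred r * pred s)) where

    layer-bound : ∀ c t → suc c + t ≡ A →
      pred q * M t < count N (has-gcd (q ^ suc c)) + count N (has-gcd (q ^ c * r))
    layer-bound c t e =
      layer-arith q r s (M t) (count N (has-gcd (q ^ suc c))) (count N (has-gcd (q ^ c * r)))
        (<-trans (s≤s z≤n) (1<M t)) (prime>1 q-prime) totient-hypothesis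
        (gcd-class-bound (q ^ suc c) (M t * r) t (suc B') C (q^>0 (suc c))
                         (shape-q r (q ^ t) (r ^ B') (s ^ C)) (cofactor-q {c} {t} e))
        (gcd-class-bound (q ^ c * r) (M t * q) (suc t) B' C (*-mono-≤ (q^>0 c) (prime>0 r-prime))
                         (shape-r q (q ^ t) (r ^ B') (s ^ C)) (cofactor-qr {c} {t} e))
      where
      shape-q : ∀ r u y z → (u * y * z) * r ≡ u * (r * y) * z
      shape-q = solve-∀
      shape-r : ∀ q u y z → (u * y * z) * q ≡ (q * u) * y * z
      shape-r = solve-∀

    -- each step M t ↦ M (1 + t) = M t + (q - 1)·M t is paid for by one layer
    step : ∀ c t → suc c + t ≡ A → M (suc t) + L c < M t + L (suc c)
    step c t e = begin-strict
        M (suc t) + L c                        ≡⟨ cong (_+ L c) M-step ⟩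
        (M t + pred q * M t) + L c             <⟨ +-monoˡ-< (L c) (+-monoʳ-< (M t) (layer-bound c t e)) ⟩
        (M t + (Kq + Kqr)) + L c               ≡⟨ +-assoc (M t) _ (L c) ⟩
        M t + ((Kq + Kqr) + L c)               ≡⟨ cong (_+_ (M t)) (trans (+-comm _ (L c)) (sym (count-layers c))) ⟩
        M t + L (suc c)                        ∎
      where
      open ≤-Reasoning
      Kq Kqr : ℕ
      Kq  = count N (has-gcd (q ^ suc c))
      Kqr = count N (has-gcd (q ^ c * r))
      regroup : ∀ q u y z → q * u * y * z ≡ q * (u * y * z)
      regroup = solve-∀
      peel : ∀ q x → 0 < q → q * x ≡ x + pred q * x
      peel (suc q') x _ = refl
      M-step : M (suc t) ≡ M t + pred q * M t
      M-step = trans (regroup q (q ^ t) (r ^ B') (s ^ C)) (peel q (M t) q>0)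

    degree-comparison : ∀ β → 1 ≤ β → β ≤ A → deg N r < deg N (q ^ β * r)
    degree-comparison (suc c) _ β≤A with m≤n⇒∃[o]m+o≡n β≤A
    ... | t , e = +-cancelʳ-< 1 (deg N r) (deg N g) (begin-strict
        deg N r + 1                   ≤⟨ degree-prime-≤ n' r (M A) r-prime r·M≡N r<N ⟩
        M A + E                       ≤⟨ +-monoˡ-≤ E (m≤m+n (M A) (L 0)) ⟩
        (M A + L 0) + E               <⟨ +-monoˡ-< E (telescope M L A step c t e) ⟩
        (M t + L (suc c)) + E         ≡⟨ trans (+-assoc (M t) _ E) (cong (_+_ (M t)) (+-comm (L (suc c)) E)) ⟩
        M t + (E + L (suc c))         ≡⟨ cong (_+_ (M t)) (count-units-and-layers (suc c)) ⟩
        M t + count N D               ≤⟨ degree-divisor-≥ n' g (M t) (cofactor-g {c} {t} e) g<N D (proper-divisor c) ⟩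
        deg N g + 1                   ∎)
      where
      open ≤-Reasoning
      g E : ℕ
      g = q ^ suc c * r
      E = count N (unit N)
      D : ℕ → Bool
      D y = unit N y ∨ layers (suc c) y
      r<N : r < N
      r<N = subst (r <_) r·M≡N (m<m*n r (M A) {{>-nonZero (prime>0 r-prime)}} (1<M A))
      g<N : g < N
      g<N = subst (g <_) (cofactor-g {c} {t} e)
              (m<m*n g (M t) {{>-nonZero (*-mono-≤ (q^>0 (suc c)) (prime>0 r-prime))}} (1<M t))

-- The theorem for an explicit ordering (q, r, s) of the three primes of n;
-- the totient hypothesis weakens to q r s < (q + r)(r - 1)(s - 1).
degree-comparison : ∀ {q r s a b c n} → Prime q → Prime r → Prime s → q ≢ r → q ≢ s → r ≢ s →
  1 ≤ b → 1 ≤ c → n ≡ q ^ a * r ^ b * s ^ c → q * r * s < (q + r) * φ (r * s) →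
  ∀ β → 1 ≤ β → β ≤ a → deg n r < deg n (q ^ β * r)
degree-comparison {q} {r} {s} {a} {suc B'} {suc C'} {zero} q-prime r-prime s-prime _ _ _ _ _ 0≡ _ =
  ⊥-elim (<-irrefl 0≡ (*-mono-≤ (*-mono-≤ (positive q-prime a) (positive r-prime (suc B'))) (positive s-prime (suc C'))))
  where
  positive : ∀ {p} → Prime p → ∀ e → 0 < p ^ e
  positive {p} p-prime e = m^n>0 p {{>-nonZero (prime>0 p-prime)}} e
degree-comparison {q} {r} {s} {a} {suc B'} {suc C'} {suc n'} q-prime r-prime s-prime q≢r q≢s r≢s _ _ n≡ hyp =
  ThreePrimes.degree-comparison q r s a B' C' n' q-prime r-prime s-prime q≢r q≢s r≢s (sym n≡)
    (<-≤-trans hyp (*-monoʳ-≤ (q + r) (φ-two-primes r-prime s-prime r≢s)))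

positive-difference : ∀ X Y → + 0 <ℤ + X - + Y → Y < X
positive-difference X Y 0<X-Y with Y <? X
... | yes Y<X = Y<X
... | no Y≮X  = ⊥-elim (nonpositive (Y ∸ X) (subst (+ 0 <ℤ_) (trans (ℤ.m-n≡m⊖n X Y) (ℤ.⊖-≤ (≮⇒≥ Y≮X))) 0<X-Y))
  where
  nonpositive : ∀ k → ¬ (+ 0 <ℤ -ℤ (+ k))
  nonpositive zero    (+<+ ())
  nonpositive (suc k) ()

data Arrangement : Fin 3 → Fin 3 → Fin 3 → Set where
  i0j1k2 : Arrangement zero (suc zero) (suc (suc zero))
  i0j2k1 : Arrangement zero (suc (suc zero)) (suc zero)
  i1j2k0 : Arrangement (suc zero) (suc (suc zero)) zero

arrangement : ∀ i j k → toℕ i < toℕ j → k ≢ i → k ≢ j → Arrangement i j k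
arrangement zero             (suc zero)       (suc (suc zero)) _ _ _ = i0j1k2
arrangement zero             (suc (suc zero)) (suc zero)       _ _ _ = i0j2k1
arrangement (suc zero)       (suc (suc zero)) zero             _ _ _ = i1j2k0
arrangement zero             zero             _ () _ _
arrangement (suc zero)       zero             _ () _ _
arrangement (suc zero)       (suc zero)       _ (s≤s ()) _ _
arrangement (suc (suc zero)) zero             _ () _ _
arrangement (suc (suc zero)) (suc zero)       _ (s≤s ()) _ _
arrangement (suc (suc zero)) (suc (suc zero)) _ (s≤s (s≤s ())) _ _
arrangement zero             _                zero             _ k≢i _ = ⊥-elim (k≢i refl)
arrangement (suc zero)       _                (suc zero)       _ k≢i _ = ⊥-elim (k≢i refl)
arrangement _                (suc zero)       (suc zero)       _ _ k≢j = ⊥-elim (k≢j refl)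
arrangement _                (suc (suc zero)) (suc (suc zero)) _ _ k≢j = ⊥-elim (k≢j refl)

arranged-distinct : ∀ {i j k} → Arrangement i j k → (p : Fin 3 → ℕ) →
  p zero < p (suc zero) → p (suc zero) < p (suc (suc zero)) →
  p i ≢ p j × p i ≢ p k × p j ≢ p k
arranged-distinct i0j1k2 p p₀<p₁ p₁<p₂ = <⇒≢ p₀<p₁ , <⇒≢ (<-trans p₀<p₁ p₁<p₂) , <⇒≢ p₁<p₂
arranged-distinct i0j2k1 p p₀<p₁ p₁<p₂ = <⇒≢ (<-trans p₀<p₁ p₁<p₂) , <⇒≢ p₀<p₁ , ≢-sym (<⇒≢ p₁<p₂)
arranged-distinct i1j2k0 p p₀<p₁ p₁<p₂ = <⇒≢ p₁<p₂ , ≢-sym (<⇒≢ p₀<p₁) , ≢-sym (<⇒≢ (<-trans p₀<p₁ p₁<p₂))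

arranged-product : ∀ {i j k} → Arrangement i j k → (x : Fin 3 → ℕ) →
  x zero * x (suc zero) * x (suc (suc zero)) ≡ x i * x j * x k
arranged-product i0j1k2 x = refl
arranged-product i0j2k1 x = swap (x zero) (x (suc zero)) (x (suc (suc zero)))
  where
  swap : ∀ a b c → a * b * c ≡ a * c * b
  swap = solve-∀
arranged-product i1j2k0 x = rotate (x zero) (x (suc zero)) (x (suc (suc zero)))
  where
  rotate : ∀ a b c → a * b * c ≡ b * c * a
  rotate = solve-∀

lemma5p2 : (n : ℕ) (p α : Fin 3 → ℕ) →
  (∀ t → Prime (p t)) → (∀ t → 1 ≤ α t) →
  p zero < p (suc zero) → p (suc zero) < p (suc (suc zero)) →
  n ≡ p zero ^ α zero * p (suc zero) ^ α (suc zero) * p (suc (suc zero)) ^ α (suc (suc zero)) →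
  (i j k : Fin 3) → toℕ i < toℕ j → k ≢ i → k ≢ j →
  + 0 <ℤ + ((p i + p j) * φ (p j * p k)) - + (p i * p j * p k) →
  (β : ℕ) → 1 ≤ β → β ≤ α i →
  deg n (p j) < deg n (p i ^ β * p j)
lemma5p2 n p α prime 1≤α p₀<p₁ p₁<p₂ n≡ i j k i<j k≢i k≢j hypothesis =
  degree-comparison (prime i) (prime j) (prime k) (proj₁ distinct) (proj₁ (proj₂ distinct)) (proj₂ (proj₂ distinct))
    (1≤α j) (1≤α k)
    (trans n≡ (arranged-product arr (λ t → p t ^ α t)))
    (positive-difference _ _ hypothesis)
  where
  arr : Arrangement i j k
  arr = arrangement i j k i<j k≢i k≢j
  distinct : p i ≢ p j × p i ≢ p k × p j ≢ p k
  distinct = arranged-distinct arr p p₀<p₁ p₁<p₂
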